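{- Let $D$ be an oriented graph. Then $\operatorname{inv}(D) = 1$ if and only if $\operatorname{inv}(D\rightarrow D)= 2$, where $D\rightarrow D$ denotes the dijoin of two disjoint copies of $D$.
   Context: An oriented graph is a digraph with no loops, no multiple arcs and no directed cycle of length 2. Inverting a vertex set $X$ means reversing every arc with both ends in $X$. $\operatorname{inv}(D)$ is the minimum number of successive inversions needed to make the oriented graph $D$ acyclic. The dijoin $L\rightarrow R$ is obtained from the disjoint union of $L$ and $R$ by adding all arcs from $V(L)$ to $V(R)$. -}

module Defs where

open import Data.Nat using (ℕ; _+_; _<_)
open import Data.Fin using (Fin; splitAt)
open import Data.Bool using (Bool; true; false; _∧_; if_then_else_)
open import Data.Sum using (_⊎_; inj₁; inj₂)
open import Data.Product using (Σ; _×_)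
open import Data.List using (List; []; _∷_; length)
open import Relation.Binary.PropositionalEquality using (_≡_)
open import Relation.Nullary using (¬_)

Digraph : ℕ → Set
Digraph n = Fin n → Fin n → Bool

Arc : ∀ {n} → Digraph n → Fin n → Fin n → Set
Arc A i j = A i j ≡ true

-- Oriented graph: no loops, no directed 2-cycles (no multiple arcs is
-- automatic for an adjacency relation).
Oriented : ∀ {n} → Digraph n → Set
Oriented A = (∀ i → ¬ Arc A i i) × (∀ i j → Arc A i j → ¬ Arc A j i)

VSet : ℕ → Set
VSet n = Fin n → Bool

invert : ∀ {n} → VSet n → Digraph n → Digraph n
invert X A i j = if X i ∧ X j then A j i else A i j

invertAll : ∀ {n} → List (VSet n) → Digraph n → Digraph n
invertAll []       A = A
invertAll (X ∷ Xs) A = invertAll Xs (invert X A)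

data Walk⁺ {n} (A : Digraph n) : Fin n → Fin n → Set where
  arc  : ∀ {i j} → Arc A i j → Walk⁺ A i j
  _∷ʷ_ : ∀ {i j k} → Arc A i j → Walk⁺ A j k → Walk⁺ A i k

Acyclic : ∀ {n} → Digraph n → Set
Acyclic A = ∀ i → ¬ Walk⁺ A i i

InvEq : ∀ {n} → Digraph n → ℕ → Set
InvEq A k =
  Σ (List (VSet _)) (λ Xs → (length Xs ≡ k) × Acyclic (invertAll Xs A))
  × (∀ (Xs : List (VSet _)) → length Xs < k → ¬ Acyclic (invertAll Xs A))

dijoin : ∀ {m n} → Digraph m → Digraph n → Digraph (m + n)
dijoin {m} L R u v with splitAt m u | splitAt m v
... | inj₁ i | inj₁ j = L i j
... | inj₂ i | inj₂ j = R i j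
... | inj₁ _ | inj₂ _ = true
... | inj₂ _ | inj₁ _ = false

-- If X makes D acyclic, inverting X in the left copy and then in the right
-- copy makes D → D acyclic. A single inversion Y cannot: a cycle of D either
-- survives in one copy, or it leaves Y in both copies, and the two exit arcs
-- together with an arc from left to right close a triangle.
--
-- Conversely, let Y, Z make D → D acyclic and label each vertex by its
-- membership in (Y , Z) as a vector of 𝔽₂²; an arc is reversed exactly when
-- its ends have labels of inner product 1. If the right copy carries at most one
-- nonzero label, the two inversions act on it like the single inversion of its
-- vertices of odd parity. Otherwise it carries two distinct nonzero labels e, e′,
-- and to avoid triangles the left copy's arcs must ascend in (· e , · e′); ranking
-- labels by this order shows that the odd-parity inversion of the left copy is
-- acyclic.

module Submission where

open import Defs
open import Data.Nat using (ℕ; _+_; _<_; z≤n; s≤s)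
open import Data.Nat.Properties using (<-trans; <-irrefl; _<?_)
open import Data.Fin using (Fin; _↑ˡ_; _↑ʳ_; splitAt)
open import Data.Fin.Properties using (splitAt-↑ˡ; splitAt-↑ʳ; any?)
open import Data.Bool using (Bool; true; false; _∧_; _xor_; if_then_else_)
open import Data.Bool.Properties using (∧-comm; ∧-zeroʳ) renaming (_≟_ to _≟ᵇ_)
open import Data.Sum using (_⊎_; inj₁; inj₂; [_,_])
open import Data.Product using (Σ-syntax; _×_; _,_; proj₁; proj₂)
open import Data.Product.Properties using (≡-dec)
open import Data.List using ([]; _∷_)
open import Data.Empty using (⊥-elim)
open import Function using (_∘_; id; const)
open import Relation.Binary.Definitions using (DecidableEquality)
open import Relation.Binary.PropositionalEquality
  using (_≡_; _≢_; refl; sym; trans; cong; cong₂; subst)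
open import Relation.Nullary using (¬_; yes; no; Dec; _×-dec_; _⊎-dec_; _→-dec_; ¬?; contradiction)
open import Relation.Nullary.Decidable using (decidable-stable; from-yes; map′)

Walk⁺-map : ∀ {m k} {A : Digraph m} {B : Digraph k} (φ : Fin m → Fin k) →
  (∀ {u v} → Arc A u v → Arc B (φ u) (φ v)) →
  ∀ {i j} → Walk⁺ A i j → Walk⁺ B (φ i) (φ j)
Walk⁺-map φ hom (arc a)  = arc (hom a)
Walk⁺-map φ hom (a ∷ʷ w) = hom a ∷ʷ Walk⁺-map φ hom w

acyclic-by-hom : ∀ {m k} {A : Digraph m} {B : Digraph k} (φ : Fin m → Fin k) →
  (∀ {u v} → Arc A u v → Arc B (φ u) (φ v)) → Acyclic B → Acyclic A
acyclic-by-hom φ hom acB i w = acB (φ i) (Walk⁺-map φ hom w)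

acyclic-resp : ∀ {m} {A B : Digraph m} → (∀ u v → A u v ≡ B u v) → Acyclic B → Acyclic A
acyclic-resp A≗B = acyclic-by-hom id (λ {u} {v} a → trans (sym (A≗B u v)) a)

_∷ʳʷ_ : ∀ {m} {A : Digraph m} {i j k} → Walk⁺ A i j → Arc A j k → Walk⁺ A i k
arc a    ∷ʳʷ b = a ∷ʷ arc b
(a ∷ʷ w) ∷ʳʷ b = a ∷ʷ (w ∷ʳʷ b)

module _ {m} {A B : Digraph m} (ρ : Fin m → ℕ)
         (step : ∀ {u v} → Arc A u v → ρ u < ρ v ⊎ (ρ u ≡ ρ v × Arc B u v)) where

  rank-walk : ∀ {i j} → Walk⁺ A i j → ρ i < ρ j ⊎ (ρ i ≡ ρ j × Walk⁺ B i j)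
  rank-walk (arc a) with step a
  ... | inj₁ lt       = inj₁ lt
  ... | inj₂ (eq , b) = inj₂ (eq , arc b)
  rank-walk (a ∷ʷ w) with step a | rank-walk w
  ... | inj₁ lt       | inj₁ lt′        = inj₁ (<-trans lt lt′)
  ... | inj₁ lt       | inj₂ (eq′ , _)  = inj₁ (subst (ρ _ <_) eq′ lt)
  ... | inj₂ (eq , _) | inj₁ lt′        = inj₁ (subst (_< ρ _) (sym eq) lt′)
  ... | inj₂ (eq , b) | inj₂ (eq′ , w′) = inj₂ (trans eq eq′ , b ∷ʷ w′)

  acyclic-by-rank : Acyclic B → Acyclic A
  acyclic-by-rank acB i w with rank-walk w
  ... | inj₁ lt      = <-irrefl refl lt
  ... | inj₂ (_ , w′) = acB i w′

ExitArc : ∀ {m} → Digraph m → VSet m → Set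
ExitArc A X = Σ[ x ∈ _ ] Σ[ y ∈ _ ] Arc A x y × X x ≡ true × X y ≡ false

module _ {m} {A : Digraph m} {X : VSet m} where

  invert-inside : ∀ {i j} → X i ≡ true → X j ≡ true → Arc A i j → Arc (invert X A) j i
  invert-inside {i} {j} xi xj a rewrite xi | xj = a

  invert-outsideˡ : ∀ {i j} → X i ≡ false → Arc A i j → Arc (invert X A) i j
  invert-outsideˡ xi a rewrite xi = a

  invert-outsideʳ : ∀ {i j} → X j ≡ false → Arc A i j → Arc (invert X A) i j
  invert-outsideʳ {i} {j} xj a rewrite xj | ∧-zeroʳ (X i) = a

  exit-of-walk : ∀ {i k} → X i ≡ true → X k ≡ false → Walk⁺ A i k → ExitArc A X
  exit-of-walk xi xk (arc a) = _ , _ , a , xi , xk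
  exit-of-walk xi xk (_∷ʷ_ {j = j} a w) with X j in xj
  ... | true  = exit-of-walk xj xk w
  ... | false = _ , _ , a , xi , xj

  reverse-or-exit : ∀ {i k} → X i ≡ true → Walk⁺ A i k → Walk⁺ (invert X A) k i ⊎ ExitArc A X
  reverse-or-exit {k = k} xi (arc a) with X k in xk
  ... | true  = inj₁ (arc (invert-inside xi xk a))
  ... | false = inj₂ (_ , _ , a , xi , xk)
  reverse-or-exit xi (_∷ʷ_ {j = j} a w) with X j in xj
  ... | false = inj₂ (_ , _ , a , xi , xj)
  ... | true with reverse-or-exit xj w
  ...   | inj₁ w′ = inj₁ (w′ ∷ʳʷ invert-inside xi xj a)
  ...   | inj₂ e  = inj₂ e

  keep-or-exit : ∀ {i k} → X i ≡ false → X k ≡ false → Walk⁺ A i k →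
    Walk⁺ (invert X A) i k ⊎ ExitArc A X
  keep-or-exit xi xk (arc a) = inj₁ (arc (invert-outsideˡ xi a))
  keep-or-exit xi xk (_∷ʷ_ {j = j} a w) with X j in xj
  ... | true  = inj₂ (exit-of-walk xj xk w)
  ... | false with keep-or-exit xj xk w
  ...   | inj₁ w′ = inj₁ (invert-outsideˡ xi a ∷ʷ w′)
  ...   | inj₂ e  = inj₂ e

  cycle-survives-or-exits : ∀ {i} → Walk⁺ A i i → (Σ[ j ∈ _ ] Walk⁺ (invert X A) j j) ⊎ ExitArc A X
  cycle-survives-or-exits {i} w with X i in xi
  ... | true with reverse-or-exit xi w
  ...   | inj₁ w′ = inj₁ (_ , w′)
  ...   | inj₂ e  = inj₂ e
  cycle-survives-or-exits {i} w | false with keep-or-exit xi xi w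
  ...   | inj₁ w′ = inj₁ (_ , w′)
  ...   | inj₂ e  = inj₂ e

record Restriction {m k} (φ : Fin m → Fin k) (A : Digraph k) (B : Digraph m) : Set where
  constructor restricts
  field agrees : ∀ i j → A (φ i) (φ j) ≡ B i j

module _ {m k} {φ : Fin m → Fin k} {A : Digraph k} {B : Digraph m} where

  restriction-acyclic : Restriction φ A B → Acyclic A → Acyclic B
  restriction-acyclic (restricts res) = acyclic-by-hom φ λ {i} {j} b → trans (res i j) b

  restriction-invert : (X : VSet k) → Restriction φ A B →
    Restriction φ (invert X A) (invert (X ∘ φ) B)
  restriction-invert X (restricts res) =
    restricts λ i j → cong₂ (if X (φ i) ∧ X (φ j) then_else_) (res j i) (res i j)

module _ {m n} (L : Digraph m) (R : Digraph n) where

  dijoin-left : Restriction (_↑ˡ n) (dijoin L R) L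
  dijoin-left = restricts agrees
    where
    agrees : ∀ i j → dijoin L R (i ↑ˡ n) (j ↑ˡ n) ≡ L i j
    agrees i j rewrite splitAt-↑ˡ m i n | splitAt-↑ˡ m j n = refl

  dijoin-right : Restriction (m ↑ʳ_) (dijoin L R) R
  dijoin-right = restricts agrees
    where
    agrees : ∀ i j → dijoin L R (m ↑ʳ i) (m ↑ʳ j) ≡ R i j
    agrees i j rewrite splitAt-↑ʳ m n i | splitAt-↑ʳ m n j = refl

  dijoin-forward : ∀ i j → dijoin L R (i ↑ˡ n) (m ↑ʳ j) ≡ true
  dijoin-forward i j rewrite splitAt-↑ˡ m i n | splitAt-↑ʳ m n j = refl

onLeft : ∀ {m} n → VSet m → VSet (m + n)
onLeft {m} n X u = [ X , const false ] (splitAt m u)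

onRight : ∀ {n} m → VSet n → VSet (m + n)
onRight m X u = [ const false , X ] (splitAt m u)

dijoin-invert-sides : ∀ {m n} (X : VSet m) (X′ : VSet n) (L : Digraph m) (R : Digraph n) u v →
  invertAll (onLeft n X ∷ onRight m X′ ∷ []) (dijoin L R) u v ≡
  dijoin (invert X L) (invert X′ R) u v
dijoin-invert-sides {m} X X′ L R u v with splitAt m u | splitAt m v
... | inj₁ i | inj₁ j = refl
... | inj₁ i | inj₂ j rewrite ∧-zeroʳ (X i) = refl
... | inj₂ i | inj₁ j rewrite ∧-zeroʳ (X′ i) = refl
... | inj₂ i | inj₂ j = refl

dijoin-acyclic : ∀ {n} {D : Digraph n} → Acyclic D → Acyclic (dijoin D D)
dijoin-acyclic {n} {D} acD =
  acyclic-by-rank side step (acyclic-by-hom fold id acD)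
  where
  side : Fin (n + n) → ℕ
  side u = [ const 0 , const 1 ] (splitAt n u)

  fold : Fin (n + n) → Fin n
  fold u = [ id , id ] (splitAt n u)

  step : ∀ {u v} → Arc (dijoin D D) u v →
         side u < side v ⊎ (side u ≡ side v × Arc (λ u v → D (fold u) (fold v)) u v)
  step {u} {v} a with splitAt n u | splitAt n v
  ... | inj₁ _ | inj₁ _ = inj₂ (refl , a)
  ... | inj₂ _ | inj₂ _ = inj₂ (refl , a)
  ... | inj₁ _ | inj₂ _ = inj₁ (s≤s z≤n)
  ... | inj₂ _ | inj₁ _ = contradiction a λ ()

dijoin-one-inversion : ∀ {m n} {L : Digraph m} {R : Digraph n} (Y : VSet (m + n)) →
  Acyclic (invert Y (dijoin L R)) → ∀ {i j} → Walk⁺ L i i → ¬ Walk⁺ R j j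
dijoin-one-inversion {m} {n} {L} {R} Y ac cycleL cycleR
  with cycle-survives-or-exits {X = Y ∘ (_↑ˡ n)} cycleL
     | cycle-survives-or-exits {X = Y ∘ (m ↑ʳ_)} cycleR
... | inj₁ (_ , w) | _ = restriction-acyclic (restriction-invert Y (dijoin-left L R)) ac _ w
... | inj₂ _ | inj₁ (_ , w) = restriction-acyclic (restriction-invert Y (dijoin-right L R)) ac _ w
... | inj₂ (x , y , xy , x∈Y , y∉Y) | inj₂ (x′ , _ , _ , x′∈Y , _) =
  ac (x ↑ˡ n) (x→y ∷ʷ (y→x′ ∷ʷ arc x′→x))
  where
  F : Digraph (m + n)
  F = invert Y (dijoin L R)
  x→y : Arc F (x ↑ˡ n) (y ↑ˡ n)
  x→y  = invert-outsideʳ {A = dijoin L R} {X = Y} y∉Y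
           (trans (Restriction.agrees (dijoin-left L R) x y) xy)
  y→x′ : Arc F (y ↑ˡ n) (m ↑ʳ x′)
  y→x′ = invert-outsideˡ {A = dijoin L R} {X = Y} y∉Y (dijoin-forward L R y x′)
  x′→x : Arc F (m ↑ʳ x′) (x ↑ˡ n)
  x′→x = invert-inside {A = dijoin L R} {X = Y} x∈Y x′∈Y (dijoin-forward L R x x′)

-- A vertex is labelled by its membership in (Y , Z), read as a vector of 𝔽₂²;
-- _·_ is the standard bilinear form and parity a = a · a.
Label : Set
Label = Bool × Bool

outside : Label
outside = false , false

_≟ˡ_ : DecidableEquality Label
_≟ˡ_ = ≡-dec _≟ᵇ_ _≟ᵇ_

label : ∀ {m} → VSet m → VSet m → Fin m → Label
label Y Z u = Y u , Z u

_·_ : Label → Label → Bool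
(a₁ , a₂) · (b₁ , b₂) = (a₁ ∧ b₁) xor (a₂ ∧ b₂)

parity : Label → Bool
parity (a₁ , a₂) = a₁ xor a₂

·-comm : ∀ a b → a · b ≡ b · a
·-comm (a₁ , a₂) (b₁ , b₂) = cong₂ _xor_ (∧-comm a₁ b₁) (∧-comm a₂ b₂)

·-outsideʳ : ∀ a → a · outside ≡ false
·-outsideʳ (a₁ , a₂) rewrite ∧-zeroʳ a₁ | ∧-zeroʳ a₂ = refl

·-self : ∀ a → a · a ≡ parity a ∧ parity a
·-self (false , false) = refl
·-self (false , true)  = refl
·-self (true  , false) = refl
·-self (true  , true)  = refl

invert-twice : ∀ {m} (Y Z : VSet m) (A : Digraph m) u v →
  invert Z (invert Y A) u v ≡ (if label Y Z u · label Y Z v then A v u else A u v)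
invert-twice Y Z A u v rewrite ∧-comm (Y v) (Y u) = if-xor (Y u ∧ Y v) (Z u ∧ Z v)
  where
  if-xor : ∀ p q {x y : Bool} →
    (if q then (if p then x else y) else (if p then y else x)) ≡ (if p xor q then y else x)
  if-xor false false = refl
  if-xor false true  = refl
  if-xor true  false = refl
  if-xor true  true  = refl

·-on-line : ∀ {e a b} → a ≡ outside ⊎ a ≡ e → b ≡ outside ⊎ b ≡ e →
  a · b ≡ parity a ∧ parity b
·-on-line         (inj₁ refl) _           = refl
·-on-line {e}     (inj₂ refl) (inj₁ refl) = trans (·-outsideʳ e) (sym (∧-zeroʳ (parity e)))
·-on-line {e}     (inj₂ refl) (inj₂ refl) = ·-self e

invert-twice-on-line : ∀ {m} (Y Z : VSet m) (A : Digraph m) {e} →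
  (∀ u → label Y Z u ≡ outside ⊎ label Y Z u ≡ e) →
  ∀ u v → invert Z (invert Y A) u v ≡ invert (parity ∘ label Y Z) A u v
invert-twice-on-line Y Z A line u v =
  trans (invert-twice Y Z A u v) (cong (if_then A v u else A u v) (·-on-line (line u) (line v)))

two-values-or-one-besides : ∀ {n} {A : Set} → DecidableEquality A → (o : A) (f : Fin n → A) →
  (Σ[ w ∈ Fin n ] Σ[ w′ ∈ Fin n ] f w ≢ o × f w′ ≢ o × f w ≢ f w′) ⊎
  (Σ[ e ∈ A ] ∀ j → f j ≡ o ⊎ f j ≡ e)
two-values-or-one-besides _≟_ o f with any? (λ w → ¬? (f w ≟ o))
... | no none = inj₂ (o , λ j → inj₁ (decidable-stable (f j ≟ o) λ fj≢o → none (j , fj≢o)))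
... | yes (w , fw≢o) with any? (λ w′ → ¬? (f w′ ≟ o) ×-dec ¬? (f w ≟ f w′))
...   | yes (w′ , fw′≢o , fw≢fw′) = inj₁ (w , w′ , fw≢o , fw′≢o , fw≢fw′)
...   | no none = inj₂ (f w , on-line)
  where
  on-line : ∀ j → f j ≡ o ⊎ f j ≡ f w
  on-line j with f j ≟ o
  ... | yes fj≡o = inj₁ fj≡o
  ... | no fj≢o  = inj₂ (sym (decidable-stable (f w ≟ f j) λ fw≢fj → none (j , fj≢o , fw≢fj)))

flips : Label → Label → Bool
flips a b = (parity a ∧ parity b) xor (a · b)

flips-comm : ∀ a b → flips a b ≡ flips b a
flips-comm a b = cong₂ _xor_ (∧-comm (parity a) (parity b)) (·-comm a b)

if-flip : ∀ s t {x y : Bool} → (if s then y else x) ≡ true →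
  (s xor t ≡ false → (if t then y else x) ≡ true) × (s xor t ≡ true → (if t then x else y) ≡ true)
if-flip false false p = (λ _ → p) , λ ()
if-flip false true  p = (λ ()) , λ _ → p
if-flip true  false p = (λ ()) , λ _ → p
if-flip true  true  p = (λ _ → p) , λ ()

∀-label? : {P : Label → Set} → (∀ a → Dec (P a)) → Dec (∀ a → P a)
∀-label? P? =
  map′ (λ (p₀₀ , p₀₁ , p₁₀ , p₁₁) → λ { (false , false) → p₀₀ ; (false , true) → p₀₁
                                       ; (true , false) → p₁₀ ; (true , true) → p₁₁ })
       (λ ∀P → ∀P _ , ∀P _ , ∀P _ , ∀P _)
       (P? (false , false) ×-dec P? (false , true) ×-dec P? (true , false) ×-dec P? (true , true))

Below : Label → Label → Label → Label → Set
Below e e′ a b = (a · e ≡ true → b · e ≡ true) × (a · e′ ≡ true → b · e′ ≡ true)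

-- For distinct nonzero e, e′ the map a ↦ (a · e , a · e′) is injective;
-- rank reverses its coordinatewise order on nonzero labels and puts outside lowest.
rank : Label → Label → Label → ℕ
rank e e′ (false , false) = 0
rank e e′ a = descending (a · e) (a · e′)
  where
  descending : Bool → Bool → ℕ
  descending true  true  = 1
  descending true  false = 2
  descending false true  = 3
  descending false false = 4

-- Decided by evaluation on all 4⁴ choices of labels.
rank-climbs : ∀ e e′ a b → e ≢ outside → e′ ≢ outside → e ≢ e′ → Below e e′ a b →
  (flips a b ≡ true → rank e e′ b < rank e e′ a) ×
  (flips a b ≡ false → a ≡ b ⊎ rank e e′ a < rank e e′ b)
rank-climbs = from-yes (∀-label? λ e → ∀-label? λ e′ → ∀-label? λ a → ∀-label? λ b →
  ¬? (e ≟ˡ outside) →-dec ¬? (e′ ≟ˡ outside) →-dec ¬? (e ≟ˡ e′) →-dec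
  (((a · e ≟ᵇ true) →-dec (b · e ≟ᵇ true)) ×-dec ((a · e′ ≟ᵇ true) →-dec (b · e′ ≟ᵇ true))) →-dec
  (((flips a b ≟ᵇ true) →-dec (rank e e′ b <? rank e e′ a)) ×-dec
   ((flips a b ≟ᵇ false) →-dec ((a ≟ˡ b) ⊎-dec (rank e e′ a <? rank e e′ b)))))

module _ {m} (L : Digraph m) (Y Z : VSet m) where

  private
    c : Fin m → Label
    c = label Y Z

  Ascending : Label → Set
  Ascending e = ∀ {u v} → Arc (invert Z (invert Y L)) u v → c u · e ≡ true → c v · e ≡ true

  -- Inverting the odd-parity vertices reverses, relative to the two inversions,
  -- exactly the arcs where flips holds; as the two inversions leave arcs
  -- ascending in e and e′, every arc then climbs in rank or stays inside a label.
  parity-inversion-acyclic : ∀ {e e′} → e ≢ outside → e′ ≢ outside → e ≢ e′ →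
    Ascending e → Ascending e′ →
    Acyclic (invert Z (invert Y L)) → Acyclic (invert (parity ∘ c) L)
  parity-inversion-acyclic {e} {e′} e≢o e′≢o e≢e′ asc asc′ =
    acyclic-by-rank (rank e e′ ∘ c) step
    where
    E′ : Digraph m
    E′ = invert Z (invert Y L)

    below : ∀ {u v} → Arc E′ u v → Below e e′ (c u) (c v)
    below a = asc a , asc′ a

    kept : ∀ {u v} → Arc (invert (parity ∘ c) L) u v → flips (c u) (c v) ≡ false → Arc E′ u v
    kept {u} {v} a fl = trans (invert-twice Y Z L u v) (proj₁ (if-flip _ (c u · c v) a) fl)

    reversed : ∀ {u v} → Arc (invert (parity ∘ c) L) u v → flips (c u) (c v) ≡ true → Arc E′ v u
    reversed {u} {v} a fl rewrite invert-twice Y Z L v u | ·-comm (c v) (c u) =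
      proj₂ (if-flip _ (c u · c v) a) fl

    step : ∀ {u v} → Arc (invert (parity ∘ c) L) u v →
      rank e e′ (c u) < rank e e′ (c v) ⊎ (rank e e′ (c u) ≡ rank e e′ (c v) × Arc E′ u v)
    step {u} {v} a with flips (c u) (c v) in fl
    ... | true = inj₁ (proj₁ (rank-climbs e e′ (c v) (c u) e≢o e′≢o e≢e′ (below (reversed a fl)))
                             (trans (flips-comm (c v) (c u)) fl))
    ... | false with proj₂ (rank-climbs e e′ (c u) (c v) e≢o e′≢o e≢e′ (below (kept a fl))) fl
    ...   | inj₁ same = inj₂ (cong (rank e e′) same , kept a fl)
    ...   | inj₂ lt   = inj₁ lt

module _ {m n} {L : Digraph m} {R : Digraph n} (Y Z : VSet (m + n))
         (ac : Acyclic (invert Z (invert Y (dijoin L R)))) where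

  private
    F : Digraph (m + n)
    F = invert Z (invert Y (dijoin L R))

    c : Fin (m + n) → Label
    c = label Y Z

    l : Fin m → Fin (m + n)
    l = _↑ˡ n

    r : Fin n → Fin (m + n)
    r = m ↑ʳ_

    left : Restriction l F (invert (Z ∘ l) (invert (Y ∘ l) L))
    left = restriction-invert Z (restriction-invert Y (dijoin-left L R))

    right : Restriction r F (invert (Z ∘ r) (invert (Y ∘ r) R))
    right = restriction-invert Z (restriction-invert Y (dijoin-right L R))

    forward-kept : ∀ i j → c (l i) · c (r j) ≡ false → Arc F (l i) (r j)
    forward-kept i j p rewrite invert-twice Y Z (dijoin L R) (l i) (r j) | p =
      dijoin-forward L R i j

    backward-reversed : ∀ i j → c (r j) · c (l i) ≡ true → Arc F (r j) (l i)
    backward-reversed i j p rewrite invert-twice Y Z (dijoin L R) (r j) (l i) | p =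
      dijoin-forward L R i j

  -- An arc of the left side descending in (· c w) would close a triangle through w.
  left-ascending : ∀ w → Ascending L (Y ∘ l) (Z ∘ l) (c (r w))
  left-ascending w {u} {v} u→v u·w with c (l v) · c (r w) in v·w
  ... | true  = refl
  ... | false = ⊥-elim (ac (l u) (trans (Restriction.agrees left u v) u→v ∷ʷ
                          (forward-kept v w v·w ∷ʷ
                           arc (backward-reversed u w (trans (·-comm (c (r w)) (c (l u))) u·w)))))

  dijoin-two-inversions :
    (Σ[ X ∈ VSet m ] Acyclic (invert X L)) ⊎ (Σ[ X ∈ VSet n ] Acyclic (invert X R))
  dijoin-two-inversions with two-values-or-one-besides _≟ˡ_ outside (c ∘ r)
  ... | inj₁ (w , w′ , w≢o , w′≢o , w≢w′) =
    inj₁ (parity ∘ label (Y ∘ l) (Z ∘ l) ,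
          parity-inversion-acyclic L (Y ∘ l) (Z ∘ l) w≢o w′≢o w≢w′
            (left-ascending w) (left-ascending w′) (restriction-acyclic left ac))
  ... | inj₂ (_ , on-line) =
    inj₂ (parity ∘ label (Y ∘ r) (Z ∘ r) ,
          acyclic-resp (λ u v → sym (invert-twice-on-line (Y ∘ r) (Z ∘ r) R on-line u v))
                       (restriction-acyclic right ac))

module _ {n} {A : Digraph n} where

  ⇒InvEq-1 : ¬ Acyclic A → Σ[ X ∈ VSet n ] Acyclic (invert X A) → InvEq A 1
  ⇒InvEq-1 ¬ac (X , acX) = (X ∷ [] , refl , acX) , λ { [] _ → ¬ac ; (_ ∷ _) (s≤s ()) }

  InvEq-1⇒ : InvEq A 1 → ¬ Acyclic A × Σ[ X ∈ VSet n ] Acyclic (invert X A)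
  InvEq-1⇒ ((X ∷ [] , _ , acX) , minimal) = minimal [] (s≤s z≤n) , X , acX

  ⇒InvEq-2 : ¬ Acyclic A → (∀ X → ¬ Acyclic (invert X A)) →
    Σ[ Y ∈ VSet n ] Σ[ Z ∈ VSet n ] Acyclic (invert Z (invert Y A)) → InvEq A 2
  ⇒InvEq-2 ¬ac ¬ac₁ (Y , Z , acYZ) =
    (Y ∷ Z ∷ [] , refl , acYZ) ,
    λ { [] _ → ¬ac ; (X ∷ []) _ → ¬ac₁ X ; (_ ∷ _ ∷ _) (s≤s (s≤s ())) }

  InvEq-2⇒ : InvEq A 2 →
    ¬ Acyclic A × Σ[ Y ∈ VSet n ] Σ[ Z ∈ VSet n ] Acyclic (invert Z (invert Y A))
  InvEq-2⇒ ((Y ∷ Z ∷ [] , _ , acYZ) , minimal) = minimal [] (s≤s z≤n) , Y , Z , acYZ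

corollary3p5 : (n : ℕ) (D : Digraph n) → Oriented D →
    (InvEq D 1 → InvEq (dijoin D D) 2) × (InvEq (dijoin D D) 2 → InvEq D 1)
corollary3p5 n D _ = one⇒two , two⇒one
  where
  one⇒two : InvEq D 1 → InvEq (dijoin D D) 2
  one⇒two inv≡1 with InvEq-1⇒ inv≡1
  ... | ¬acD , X , acX =
    ⇒InvEq-2 (¬acD ∘ restriction-acyclic (dijoin-left D D))
             (λ Y acY → ¬acD λ i cycle → dijoin-one-inversion Y acY cycle cycle)
             (onLeft n X , onRight n X ,
              acyclic-resp (dijoin-invert-sides X X D D) (dijoin-acyclic acX))

  two⇒one : InvEq (dijoin D D) 2 → InvEq D 1
  two⇒one inv≡2 with InvEq-2⇒ inv≡2
  ... | ¬acE , Y , Z , acYZ =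
    ⇒InvEq-1 (¬acE ∘ dijoin-acyclic) ([ id , id ] (dijoin-two-inversions {L = D} {R = D} Y Z acYZ))
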